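{- Let $n\ge 1$ and $L\ge 3$ be integers, and let $\mathcal{A}$ be an alphabet of $k$ letters partitioned into $L$ categories, category $i$ containing $k_i$ letters, so that $k=\sum_{i=1}^L k_i$. Call an $n$-letter word over $\mathcal{A}$ a non-password if for at least one category, no letter of that category occurs in the word. Then there exists a universal cycle for the set of $n$-letter non-passwords over $\mathcal{A}$.
   Context: For a set $\mathcal{C}$ of $n$-letter words over an alphabet, a universal cycle (U-cycle) for $\mathcal{C}$ is a cyclic sequence $x_1x_2\dots x_N$ with $N=|\mathcal{C}|$ such that the $N$ words $x_ix_{i+1}\dots x_{i+n-1}$ ($1\le i\le N$, indices taken modulo $N$) are exactly the words of $\mathcal{C}$, each occurring exactly once. -}

module Defs where

open import Data.Nat using (ℕ; zero; suc; _+_; _%_)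
open import Data.Nat.DivMod using (m%n<n)
open import Data.Fin using (Fin; toℕ; fromℕ<)
open import Data.Vec using (Vec; tabulate; lookup)
open import Data.Product using (∃)
open import Relation.Binary.PropositionalEquality using (_≡_; _≢_)

window : ∀ {A : Set} {N : ℕ} → (Fin N → A) → (n : ℕ) → Fin N → Vec A n
window {N = suc M} x n i =
  tabulate (λ j → x (fromℕ< (m%n<n (toℕ i + toℕ j) (suc M))))

-- A universal cycle for a set C of n-letter words: a cyclic sequence
-- x_1 … x_N whose N windows are exactly the words of C, each occurring
-- exactly once (so N = |C|: i ↦ window i is a bijection Fin N → C).
record UCycle (A : Set) (n : ℕ) (C : Vec A n → Set) : Set where
  field
    N     : ℕ
    seq   : Fin N → A
    inC   : ∀ i → C (window seq n i)
    cover : ∀ w → C w → ∃ λ i → window seq n i ≡ w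
    once  : ∀ i j → window seq n i ≡ window seq n j → i ≡ j

-- Alphabet Fin k, with letter a in category cat a ∈ Fin L.
-- A word is a non-password if some category has no letter in the word.
NonPassword : ∀ {k L n : ℕ} → (Fin k → Fin L) → Vec (Fin k) n → Set
NonPassword {n = n} cat w = ∃ λ (c : Fin _) → ∀ (j : Fin n) → cat (lookup w j) ≢ c

module Submission where

-- Proof idea (cycle joining in the de Bruijn graph). Write n = m + 1. A word w
-- of length n is an edge from init w to tail w between words of length m, and a
-- universal cycle for C is a closed walk through every word of C exactly once.
--
-- Non-passwords are closed under cyclic rotation, so they form a union of
-- necklaces, and each necklace is itself a closed walk. We grow a closed walk made
-- of whole necklaces: if it contains y, and x is a non-password outside it with
-- tail y = init x, the necklace of x is disjoint from it and is spliced in after y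
-- (CycleJoining.extend). Starting from the necklace of a constant word aⁿ, every
-- non-password z is reached by feeding in letters: first bⁿ, using two categories
-- only (a third is missing since L ≥ 3), then the letters of z, choosing b outside
-- the category missing from z. Adding all non-passwords gives the universal cycle.

open import Defs
open import Data.Nat using (ℕ; zero; suc; _+_; _∸_; _≤_; _<_; _%_; z≤n; s≤s; s≤s⁻¹)
open import Data.Nat.Properties
  using (≤-trans; <⇒≤; m∸n≤m; +-suc; +-identityʳ; suc-injective; m∸n+n≡m; m+[n∸m]≡n;
         m≤n⇒m<n∨m≡n)
open import Data.Nat.DivMod using (m%n<n; %-distribˡ-+; m%n%n≡m%n; m<n⇒m%n≡m; n%n≡0)
open import Data.Fin using (Fin; toℕ; fromℕ; fromℕ<; inject₁; Fin′)
  renaming (zero to fzero; suc to fsuc)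
open import Data.Fin.Properties
  using (fromℕ<-toℕ; toℕ-fromℕ; toℕ-fromℕ<; toℕ-inject₁; toℕ-inject; toℕ<n; ¬∀⟶∃¬-smallest;
         any?; all?; _≟_)
open import Data.Vec using (Vec; []; _∷_; _∷ʳ_; head; tail; init; lookup; toList; tabulate; replicate)
open import Data.Vec.Properties
  using (init-∷ʳ; cast-is-id; ∷ʳ-injective; toList-∷ʳ; toList-injective; length-toList;
         tabulate-cong; tabulate∘lookup; ≡-dec)
open import Data.Vec.Relation.Unary.All using (All; []; _∷_)
open import Data.Vec.Relation.Unary.All.Properties using (lookup⁺)
import Data.List as List
open import Data.List using (List; []; _∷_; _++_; [_]; length; applyUpTo; cartesianProductWith; allFin)
open import Data.List.Properties using (++-identityʳ; ++-assoc)
import Data.List.Relation.Unary.All as ListAll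
open import Data.List.Relation.Unary.AllPairs using (_∷_)
open import Data.List.Relation.Unary.Any using (here; there; index)
open import Data.List.Relation.Unary.Any.Properties using (lookup-index)
open import Data.List.Relation.Unary.Unique.Propositional using (Unique)
open import Data.List.Relation.Unary.Unique.Propositional.Properties using (++⁺; applyUpTo⁺₁)
open import Data.List.Membership.Propositional using (_∈_; _∉_)
open import Data.List.Membership.Propositional.Properties
  using (∈-++⁺ˡ; ∈-++⁺ʳ; ∈-++⁻; ∈-∃++; ∈-lookup; ∈-applyUpTo⁺; ∈-applyUpTo⁻;
         ∈-cartesianProductWith⁺; ∈-allFin)
open import Data.List.Membership.DecPropositional using () renaming (_∈?_ to member?)
open import Data.List.Relation.Binary.Permutation.Propositional using (_↭_; ↭-sym; ↭⇒↭ₛ)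
open import Data.List.Relation.Binary.Permutation.Propositional.Properties using (∈-resp-↭; shifts)
import Data.List.Relation.Binary.Permutation.Setoid.Properties as PermutationSetoid
open import Data.Product using (Σ; ∃; _×_; _,_; proj₁; proj₂)
open import Data.Sum using (_⊎_; inj₁; inj₂)
open import Data.Empty using (⊥-elim)
open import Function using (_∘_)
open import Relation.Nullary using (¬_; Dec; yes; no)
open import Relation.Nullary.Decidable using (¬?; decidable-stable)
open import Relation.Binary.Definitions using (DecidableEquality)
open import Relation.Binary.PropositionalEquality
  using (_≡_; _≢_; refl; sym; trans; cong; subst; subst₂; setoid; module ≡-Reasoning)

-- Words as sliding windows: feeding letters in, and cyclic rotation.
module Rotation {A : Set} where

  shift : ∀ {m} → Vec A (suc m) → A → Vec A (suc m)
  shift w b = tail w ∷ʳ b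

  rot : ∀ {m} → Vec A (suc m) → Vec A (suc m)
  rot w = shift w (head w)

  rotN : ∀ {m} → ℕ → Vec A (suc m) → Vec A (suc m)
  rotN zero    w = w
  rotN (suc j) w = rot (rotN j w)

  shiftIn : ∀ {m j} → Vec A (suc m) → Vec A j → Vec A (suc m)
  shiftIn w []       = w
  shiftIn w (b ∷ bs) = shiftIn (shift w b) bs

  tail≡init-shift : ∀ {m} (w : Vec A (suc m)) b → tail w ≡ init (shift w b)
  tail≡init-shift w b = sym (init-∷ʳ b (tail w))

  rotN-+ : ∀ {m} i j (w : Vec A (suc m)) → rotN (i + j) w ≡ rotN i (rotN j w)
  rotN-+ zero    j w = refl
  rotN-+ (suc i) j w = cong rot (rotN-+ i j w)

  rot-injective : ∀ {m} (w w′ : Vec A (suc m)) → rot w ≡ rot w′ → w ≡ w′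
  rot-injective (a ∷ u) (b ∷ v) eq with ∷ʳ-injective u v eq
  ... | refl , refl = refl

  rotN-injective : ∀ {m} j (w w′ : Vec A (suc m)) → rotN j w ≡ rotN j w′ → w ≡ w′
  rotN-injective zero    w w′ eq = eq
  rotN-injective (suc j) w w′ eq = rotN-injective j w w′ (rot-injective _ _ eq)

  toList-inj : ∀ {m} (xs ys : Vec A m) → toList xs ≡ toList ys → xs ≡ ys
  toList-inj xs ys eq = trans (sym (cast-is-id refl xs)) (toList-injective refl xs ys eq)

  -- The two "full turn" facts below are proved on the underlying lists, where
  -- lengths need not be tracked in types.
  rotList : List A → List A
  rotList []      = []
  rotList (a ∷ l) = l ++ [ a ]

  rotListN : ℕ → List A → List A
  rotListN zero    l = l
  rotListN (suc j) l = rotList (rotListN j l)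

  rotListN-suc : ∀ j l → rotListN (suc j) l ≡ rotListN j (rotList l)
  rotListN-suc zero    l = refl
  rotListN-suc (suc j) l = cong rotList (rotListN-suc j l)

  rotListN-++ : ∀ (u v : List A) → rotListN (length u) (u ++ v) ≡ v ++ u
  rotListN-++ []      v = sym (++-identityʳ v)
  rotListN-++ (a ∷ u) v = begin
      rotListN (suc (length u)) (a ∷ u ++ v)   ≡⟨ rotListN-suc (length u) (a ∷ u ++ v) ⟩
      rotListN (length u) ((u ++ v) ++ [ a ])  ≡⟨ cong (rotListN (length u)) (++-assoc u v [ a ]) ⟩
      rotListN (length u) (u ++ (v ++ [ a ]))  ≡⟨ rotListN-++ u (v ++ [ a ]) ⟩
      (v ++ [ a ]) ++ u                         ≡⟨ ++-assoc v [ a ] u ⟩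
      v ++ a ∷ u                                ∎
    where open ≡-Reasoning

  toList-rotN : ∀ {m} j (w : Vec A (suc m)) → toList (rotN j w) ≡ rotListN j (toList w)
  toList-rotN zero    w = refl
  toList-rotN (suc j) w with rotN j w | toList-rotN j w
  ... | a ∷ u | eq = trans (toList-∷ʳ a u) (cong rotList eq)

  rotN-full : ∀ {m} (w : Vec A (suc m)) → rotN (suc m) w ≡ w
  rotN-full {m} w = toList-inj _ _ (begin
      toList (rotN (suc m) w)                  ≡⟨ toList-rotN (suc m) w ⟩
      rotListN (suc m) l                       ≡⟨ cong (λ t → rotListN t l) (length-toList w) ⟨
      rotListN (length l) l                    ≡⟨ cong (rotListN (length l)) (++-identityʳ l) ⟨
      rotListN (length l) (l ++ [])            ≡⟨ rotListN-++ l [] ⟩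
      l                                        ∎)
    where
      open ≡-Reasoning
      l = toList w

  toList-shiftIn : ∀ {m j} (w : Vec A (suc m)) (bs : Vec A j) →
                   toList (shiftIn w bs) ≡ List.drop j (toList w ++ toList bs)
  toList-shiftIn w [] = sym (++-identityʳ (toList w))
  toList-shiftIn {j = suc j} (a ∷ u) (b ∷ bs) = begin
      toList (shiftIn (u ∷ʳ b) bs)
        ≡⟨ toList-shiftIn (u ∷ʳ b) bs ⟩
      List.drop j (toList (u ∷ʳ b) ++ toList bs)
        ≡⟨ cong (λ t → List.drop j (t ++ toList bs)) (toList-∷ʳ b u) ⟩
      List.drop j ((toList u ++ [ b ]) ++ toList bs)
        ≡⟨ cong (List.drop j) (++-assoc (toList u) [ b ] (toList bs)) ⟩
      List.drop j (toList u ++ b ∷ toList bs)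
        ∎
    where open ≡-Reasoning

  drop-length-++ : ∀ (xs ys : List A) → List.drop (length xs) (xs ++ ys) ≡ ys
  drop-length-++ []       ys = refl
  drop-length-++ (x ∷ xs) ys = drop-length-++ xs ys

  shiftIn-full : ∀ {m} (w v : Vec A (suc m)) → shiftIn w v ≡ v
  shiftIn-full {m} w v = toList-inj _ _ (begin
      toList (shiftIn w v)                     ≡⟨ toList-shiftIn w v ⟩
      List.drop (suc m) (l ++ toList v)        ≡⟨ cong (λ t → List.drop t (l ++ toList v)) (length-toList w) ⟨
      List.drop (length l) (l ++ toList v)     ≡⟨ drop-length-++ l (toList v) ⟩
      toList v                                 ∎)
    where
      open ≡-Reasoning
      l = toList w

-- Walks in the de Bruijn graph: vertices are words of length m, and the word w of
-- length m + 1 is an edge from init w to tail w.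
module Walks {A : Set} {m : ℕ} where

  data Walk : Vec A m → List (Vec A (suc m)) → Vec A m → Set where
    done : ∀ {u} → Walk u [] u
    step : ∀ {u v w ws} → init w ≡ u → Walk (tail w) ws v → Walk u (w ∷ ws) v

  walk-++ : ∀ {u v z xs ys} → Walk u xs v → Walk v ys z → Walk u (xs ++ ys) z
  walk-++ done       q = q
  walk-++ (step e p) q = step e (walk-++ p q)

  walk-split : ∀ {u v y post} pre → Walk u (pre ++ y ∷ post) v →
               Walk u pre (init y) × Walk (tail y) post v
  walk-split []        (step refl p) = done , p
  walk-split (x ∷ pre) (step e p)    = let p₁ , p₂ = walk-split pre p in step e p₁ , p₂

  sequence-walk : (g : ℕ → Vec A (suc m)) → (∀ i → tail (g i) ≡ init (g (suc i))) →
                  ∀ n → Walk (init (g 0)) (applyUpTo g n) (init (g n))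
  sequence-walk g adj zero    = done
  sequence-walk g adj (suc n) =
    step refl (subst (λ v → Walk v (applyUpTo (g ∘ suc) n) (init (g (suc n))))
                     (sym (adj 0)) (sequence-walk (g ∘ suc) (adj ∘ suc) n))

-- The necklace of x: its distinct rotations x, rot x, …, listed up to the least
-- period of x. It is a duplicate-free closed walk, closed under rotation.
module Necklace {A : Set} (_≟_ : DecidableEquality A) {m : ℕ} (x : Vec A (suc m)) where
  open Rotation {A}
  open Walks {A} {m}

  -- The least period of x is suc len.
  record Period : Set where
    field
      len     : ℕ
      returns : rotN (suc len) x ≡ x
      minimal : ∀ q → q < len → rotN (suc q) x ≢ x

  -- The least period exists and is at most m + 1, since rotN (m + 1) x ≡ x.
  period : Period
  period = record { len = toℕ i ; returns = decidable-stable (≡-dec _≟_ _ x) ¬¬returns ; minimal = minimal }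
    where
      Moves : Fin (suc m) → Set
      Moves i = rotN (suc (toℕ i)) x ≢ x
      notAllMove : ¬ (∀ i → Moves i)
      notAllMove all = all (fromℕ m) (subst (λ t → rotN (suc t) x ≡ x) (sym (toℕ-fromℕ m)) (rotN-full x))
      smallest = ¬∀⟶∃¬-smallest (suc m) Moves (λ i → ¬? (≡-dec _≟_ _ x)) notAllMove
      i = proj₁ smallest
      ¬¬returns = proj₁ (proj₂ smallest)
      minimal : ∀ q → q < toℕ i → rotN (suc q) x ≢ x
      minimal q q<i = subst (λ t → rotN (suc t) x ≢ x) (trans (toℕ-inject j) (toℕ-fromℕ< q<i))
                            (proj₂ (proj₂ smallest) j)
        where j : Fin′ i
              j = fromℕ< q<i

  open Period period

  rotations : ℕ → Vec A (suc m)
  rotations i = rotN i x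

  necklace : List (Vec A (suc m))
  necklace = applyUpTo rotations (suc len)

  x∈necklace : x ∈ necklace
  x∈necklace = ∈-applyUpTo⁺ rotations (s≤s z≤n)

  necklace-walk : Walk (init x) necklace (init x)
  necklace-walk = subst (λ v → Walk (init x) necklace (init v)) returns
    (sequence-walk rotations (λ i → tail≡init-shift (rotN i x) _) (suc len))

  -- Two equal rotations rotN i x ≡ rotN j x with i < j would give the smaller
  -- period j - i.
  necklace-unique : Unique necklace
  necklace-unique = applyUpTo⁺₁ rotations (suc len) distinct
    where
      distinct : ∀ {i j} → i < j → j < suc len → rotN i x ≢ rotN j x
      distinct {i} {suc q} (s≤s i≤q) (s≤s q<len) eq =
        minimal (q ∸ i) (≤-trans (s≤s (m∸n≤m q i)) q<len) (sym (rotN-injective i _ _ (begin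
          rotN i x                     ≡⟨ eq ⟩
          rotN (suc q) x               ≡⟨ cong (λ t → rotN t x) q+1≡i+d ⟩
          rotN (i + suc (q ∸ i)) x     ≡⟨ rotN-+ i (suc (q ∸ i)) x ⟩
          rotN i (rotN (suc (q ∸ i)) x) ∎)))
        where
          open ≡-Reasoning
          q+1≡i+d : suc q ≡ i + suc (q ∸ i)
          q+1≡i+d = sym (trans (+-suc i (q ∸ i)) (cong suc (m+[n∸m]≡n i≤q)))

  necklace-elements : ∀ {w} → w ∈ necklace → ∃ λ i → i < suc len × w ≡ rotN i x
  necklace-elements = ∈-applyUpTo⁻ rotations

  necklace-rot-closed : ∀ {w} → w ∈ necklace → rot w ∈ necklace
  necklace-rot-closed w∈ with necklace-elements w∈
  ... | i , i<p , refl with m≤n⇒m<n∨m≡n i<p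
  ...   | inj₁ i+1<p  = ∈-applyUpTo⁺ rotations i+1<p
  ...   | inj₂ i+1≡p = subst (_∈ necklace) (sym (trans (cong (λ t → rotN t x) i+1≡p) returns)) x∈necklace

  necklace-returns : ∀ {w} → w ∈ necklace → ∃ λ j → rotN j w ≡ x
  necklace-returns w∈ with necklace-elements w∈
  ... | i , i<p , refl = suc len ∸ i , (begin
      rotN (suc len ∸ i) (rotN i x)  ≡⟨ rotN-+ (suc len ∸ i) i x ⟨
      rotN (suc len ∸ i + i) x       ≡⟨ cong (λ t → rotN t x) (m∸n+n≡m (<⇒≤ i<p)) ⟩
      rotN (suc len) x               ≡⟨ returns ⟩
      x                              ∎)
    where open ≡-Reasoning

module CycleJoining {A : Set} (_≟_ : DecidableEquality A) {m : ℕ}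
                    (C : Vec A (suc m) → Set) (C-rot : ∀ {w} → C w → C (Rotation.rot w)) where
  open Rotation {A}
  open Walks {A} {m}

  Word : Set
  Word = Vec A (suc m)

  C-rotN : ∀ j {w} → C w → C (rotN j w)
  C-rotN zero    c = c
  C-rotN (suc j) c = C-rot (C-rotN j c)

  -- A closed walk through distinct words of C, which is a union of necklaces.
  record Cycle : Set where
    constructor cycle
    field
      words      : List Word
      base       : Vec A m
      closed     : Walk base words base
      distinct   : Unique words
      inC        : ∀ {w} → w ∈ words → C w
      rot-closed : ∀ {w} → w ∈ words → rot w ∈ words
  open Cycle public

  _⊑_ : Cycle → Cycle → Set
  s ⊑ s′ = ∀ {z} → z ∈ words s → z ∈ words s′

  rot-closedN : ∀ {ws : List Word} → (∀ {w} → w ∈ ws → rot w ∈ ws) → ∀ j {w} → w ∈ ws → rotN j w ∈ ws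
  rot-closedN closed zero    w∈ = w∈
  rot-closedN closed (suc j) w∈ = closed (rot-closedN closed j w∈)

  necklace-cycle : ∀ {x} → C x → Σ Cycle λ s → x ∈ words s
  necklace-cycle {x} cx = cycle necklace (init x) necklace-walk necklace-unique inC′ necklace-rot-closed
                        , x∈necklace
    where
      open Necklace _≟_ x
      inC′ : ∀ {w} → w ∈ necklace → C w
      inC′ w∈ with necklace-elements w∈
      ... | i , _ , refl = C-rotN i cx

  -- If the closed walk ws = pre ++ y ∷ post is closed under
  -- rotation, a word x ∉ ws has its whole necklace outside ws; when tail y = init x
  -- that necklace, a closed walk at init x, can be inserted right after y.
  splice : ∀ {u x y} pre post → let ws = pre ++ y ∷ post in
           Walk u ws u → Unique ws → (∀ {w} → w ∈ ws → C w) → (∀ {w} → w ∈ ws → rot w ∈ ws) →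
           x ∉ ws → C x → tail y ≡ init x →
           Σ Cycle λ s′ → x ∈ words s′ × (∀ {z} → z ∈ ws → z ∈ words s′)
  splice {u} {x} {y} pre post ws-closed ws-distinct ws-inC ws-rot-closed x∉ws cx y→x =
    cycle new u new-closed new-distinct new-inC new-rot-closed , fresh x∈necklace , old
    where
      open Necklace _≟_ x
      ws  = pre ++ y ∷ post
      new = pre ++ y ∷ necklace ++ post

      new-closed : Walk u new u
      new-closed = let before , after = walk-split pre ws-closed in
        walk-++ before (step refl (walk-++ (subst (λ v → Walk v necklace v) (sym y→x) necklace-walk) after))

      reorder : new ↭ necklace ++ ws
      reorder = subst₂ _↭_ (++-assoc pre [ y ] (necklace ++ post))
                           (cong (necklace ++_) (++-assoc pre [ y ] post))
                           (shifts (pre ++ [ y ]) necklace)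

      old : ∀ {z} → z ∈ ws → z ∈ new
      old z∈ = ∈-resp-↭ (↭-sym reorder) (∈-++⁺ʳ necklace z∈)

      fresh : ∀ {z} → z ∈ necklace → z ∈ new
      fresh z∈ = ∈-resp-↭ (↭-sym reorder) (∈-++⁺ˡ z∈)

      origin : ∀ {z} → z ∈ new → z ∈ necklace ⊎ z ∈ ws
      origin z∈ = ∈-++⁻ necklace (∈-resp-↭ reorder z∈)

      -- A common word would make x a rotation of a word of ws, hence x ∈ ws.
      disjoint : ∀ {z} → ¬ (z ∈ necklace × z ∈ ws)
      disjoint (z∈necklace , z∈ws) with necklace-returns z∈necklace
      ... | j , rotN-j-z≡x = x∉ws (subst (_∈ ws) rotN-j-z≡x (rot-closedN ws-rot-closed j z∈ws))

      new-distinct : Unique new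
      new-distinct = PermutationSetoid.Unique-resp-↭ (setoid Word) (↭⇒↭ₛ (↭-sym reorder))
                       (++⁺ necklace-unique ws-distinct disjoint)

      new-inC : ∀ {w} → w ∈ new → C w
      new-inC w∈ with origin w∈
      ... | inj₂ w∈ws = ws-inC w∈ws
      ... | inj₁ w∈necklace with necklace-elements w∈necklace
      ...   | i , _ , refl = C-rotN i cx

      new-rot-closed : ∀ {w} → w ∈ new → rot w ∈ new
      new-rot-closed w∈ with origin w∈
      ... | inj₁ w∈necklace = fresh (necklace-rot-closed w∈necklace)
      ... | inj₂ w∈ws       = old (ws-rot-closed w∈ws)

  extend : (s : Cycle) → ∀ {y x} → y ∈ words s → C x → tail y ≡ init x →
           Σ Cycle λ s′ → x ∈ words s′ × s ⊑ s′
  extend s@(cycle ws u closed distinct inC rot-closed) {y} {x} y∈ cx y→x with member? (≡-dec _≟_) x ws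
  ... | yes x∈ = s , x∈ , λ z∈ → z∈
  ... | no x∉ with ∈-∃++ y∈
  ...   | pre , post , refl = splice pre post closed distinct inC rot-closed x∉ cx y→x
-- Reading a universal cycle off a closed walk that passes through every word of C
-- exactly once: the cycle consists of the first letters of the words of the walk.
module ReadOff {A : Set} {m : ℕ} (C : Vec A (suc m) → Set) where
  open Walks {A} {m}

  Word : Set
  Word = Vec A (suc m)

  -- The j-th word of a list, with a default d beyond its end; this avoids carrying
  -- bound proofs through the index arithmetic.
  nth : Word → List Word → ℕ → Word
  nth d []       j       = d
  nth d (w ∷ ws) zero    = w
  nth d (w ∷ ws) (suc j) = nth d ws j

  lookup≡nth : ∀ d (ws : List Word) j (j<n : j < length ws) → List.lookup ws (fromℕ< j<n) ≡ nth d ws j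
  lookup≡nth d (w ∷ ws) zero    _   = refl
  lookup≡nth d (w ∷ ws) (suc j) j<n = lookup≡nth d ws j (s≤s⁻¹ j<n)

  walk-adjacent : ∀ d {u v ws} → Walk u ws v → ∀ j → suc j < length ws →
                  tail (nth d ws j) ≡ init (nth d ws (suc j))
  walk-adjacent d (step _ (step e _)) zero    _   = sym e
  walk-adjacent d (step _ done)       zero    (s≤s ())
  walk-adjacent d (step _ p)          (suc j) j<n = walk-adjacent d p j (s≤s⁻¹ j<n)

  walk-last : ∀ d {u v ws} → Walk u ws v → ∀ j → suc j ≡ length ws → tail (nth d ws j) ≡ v
  walk-last d (step _ done)       zero    _   = refl
  walk-last d (step _ (step _ _)) zero    ()
  walk-last d (step _ p)          (suc j) j≡n = walk-last d p j (suc-injective j≡n)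

  lookup-zero : (w : Word) → lookup w fzero ≡ head w
  lookup-zero (a ∷ w) = refl

  lookup-suc : (w : Word) (j : Fin m) → lookup w (fsuc j) ≡ lookup (tail w) j
  lookup-suc (a ∷ w) j = refl

  lookup-init : ∀ {n} (w : Vec A (suc n)) (j : Fin n) → lookup (init w) j ≡ lookup w (inject₁ j)
  lookup-init (a ∷ b ∷ w) fzero    = refl
  lookup-init (a ∷ b ∷ w) (fsuc j) = lookup-init (b ∷ w) j

  overlap-lookup : (F : ℕ → Word) → (∀ y → tail (F y) ≡ init (F (suc y))) →
                   ∀ t y (j : Fin (suc m)) → toℕ j ≡ t → lookup (F y) j ≡ head (F (y + t))
  overlap-lookup F adj zero y fzero refl = begin
      lookup (F y) fzero  ≡⟨ lookup-zero (F y) ⟩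
      head (F y)          ≡⟨ cong (head ∘ F) (+-identityʳ y) ⟨
      head (F (y + 0))    ∎
    where open ≡-Reasoning
  overlap-lookup F adj (suc t) y (fsuc j) j≡t = begin
      lookup (F y) (fsuc j)                ≡⟨ lookup-suc (F y) j ⟩
      lookup (tail (F y)) j                ≡⟨ cong (λ v → lookup v j) (adj y) ⟩
      lookup (init (F (suc y))) j          ≡⟨ lookup-init (F (suc y)) j ⟩
      lookup (F (suc y)) (inject₁ j)       ≡⟨ overlap-lookup F adj t (suc y) (inject₁ j)
                                                (trans (toℕ-inject₁ j) (suc-injective j≡t)) ⟩
      head (F (suc y + t))                 ≡⟨ cong (head ∘ F) (+-suc y t) ⟨
      head (F (y + suc t))                 ∎
    where open ≡-Reasoning

  unique-lookup : ∀ {ws : List Word} → Unique ws → ∀ i j → List.lookup ws i ≡ List.lookup ws j → i ≡ j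
  unique-lookup (_ ∷ _)      fzero    fzero    _ = refl
  unique-lookup (w≢ ∷ _)     fzero    (fsuc j) e = ⊥-elim (ListAll.lookup w≢ (∈-lookup j) e)
  unique-lookup (w≢ ∷ _)     (fsuc i) fzero    e = ⊥-elim (ListAll.lookup w≢ (∈-lookup i) (sym e))
  unique-lookup (_ ∷ unique) (fsuc i) (fsuc j) e = cong fsuc (unique-lookup unique i j e)

  -- A closed walk through distinct words, consisting of the words of C, is a
  -- universal cycle for C (the last hypothesis only says the walk is non-empty).
  universal-cycle : (ws : List Word) {u : Vec A m} → Walk u ws u → Unique ws →
                    (∀ {w} → w ∈ ws → C w) → (∀ w → C w → w ∈ ws) → ∀ {x} → x ∈ ws → UCycle A (suc m) C
  universal-cycle (w₀ ∷ ws′) {u} closed@(step init-w₀≡u _) distinct inC complete _ = record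
      { N     = N
      ; seq   = seq
      ; inC   = λ i → subst C (sym (window≡lookup i)) (inC (∈-lookup i))
      ; cover = λ w cw → index (complete w cw)
                       , trans (window≡lookup (index (complete w cw))) (sym (lookup-index (complete w cw)))
      ; once  = λ i j e → unique-lookup distinct i j (trans (sym (window≡lookup i)) (trans e (window≡lookup j)))
      }
    where
      ws = w₀ ∷ ws′
      N  = length ws

      word : ℕ → Word
      word = nth w₀ ws

      seq : Fin N → A
      seq i = head (word (toℕ i))

      cyclic-adjacent : ∀ j → j < N → tail (word j) ≡ init (word (suc j % N))
      cyclic-adjacent j j<N with m≤n⇒m<n∨m≡n j<N
      ... | inj₁ j+1<N = trans (walk-adjacent w₀ closed j j+1<N) (cong (init ∘ word) (sym (m<n⇒m%n≡m j+1<N)))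
      ... | inj₂ j+1≡N = trans (walk-last w₀ closed j j+1≡N)
                           (trans (sym init-w₀≡u) (cong (init ∘ word) (sym (trans (cong (_% N) j+1≡N) (n%n≡0 N)))))

      F : ℕ → Word
      F y = word (y % N)

      F-adjacent : ∀ y → tail (F y) ≡ init (F (suc y))
      F-adjacent y = trans (cyclic-adjacent (y % N) (m%n<n y N)) (cong (init ∘ word) (sym suc-mod))
        where
          suc-mod : suc y % N ≡ suc (y % N) % N
          suc-mod = trans (%-distribˡ-+ 1 y N)
                     (trans (cong (λ t → (1 % N + t) % N) (sym (m%n%n≡m%n y N))) (sym (%-distribˡ-+ 1 (y % N) N)))

      window≡lookup : ∀ i → window seq (suc m) i ≡ List.lookup ws i
      window≡lookup i = begin
          window seq (suc m) i                       ≡⟨ tabulate-cong letter ⟩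
          tabulate (lookup (F (toℕ i)))               ≡⟨ tabulate∘lookup (F (toℕ i)) ⟩
          word (toℕ i % N)                            ≡⟨ cong word (m<n⇒m%n≡m (toℕ<n i)) ⟩
          word (toℕ i)                                ≡⟨ lookup≡nth w₀ ws (toℕ i) (toℕ<n i) ⟨
          List.lookup ws (fromℕ< (toℕ<n i))           ≡⟨ cong (List.lookup ws) (fromℕ<-toℕ i (toℕ<n i)) ⟩
          List.lookup ws i                            ∎
        where
          open ≡-Reasoning
          letter : ∀ j → seq (fromℕ< (m%n<n (toℕ i + toℕ j) N)) ≡ lookup (F (toℕ i)) j
          letter j = trans (cong (head ∘ word) (toℕ-fromℕ< (m%n<n (toℕ i + toℕ j) N)))
                           (sym (overlap-lookup F F-adjacent (toℕ j) (toℕ i) j refl))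
third-category : ∀ {L} → 3 ≤ L → (p q : Fin L) → ∃ λ r → r ≢ p × r ≢ q
third-category (s≤s (s≤s (s≤s _))) fzero        fzero        = fsuc fzero , (λ ()) , (λ ())
third-category (s≤s (s≤s (s≤s _))) fzero        (fsuc fzero) = fsuc (fsuc fzero) , (λ ()) , (λ ())
third-category (s≤s (s≤s (s≤s _))) fzero (fsuc (fsuc q))     = fsuc fzero , (λ ()) , (λ ())
third-category (s≤s (s≤s (s≤s _))) (fsuc fzero) fzero        = fsuc (fsuc fzero) , (λ ()) , (λ ())
third-category (s≤s (s≤s (s≤s _))) (fsuc (fsuc p)) fzero     = fsuc fzero , (λ ()) , (λ ())
third-category (s≤s (s≤s (s≤s _))) (fsuc p)     (fsuc q)     = fzero , (λ ()) , (λ ())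

allWords : ∀ {A : Set} → List A → (n : ℕ) → List (Vec A n)
allWords as zero    = [ [] ]
allWords as (suc n) = cartesianProductWith _∷_ as (allWords as n)

allWords-complete : ∀ {A : Set} (as : List A) → (∀ a → a ∈ as) → ∀ {n} (v : Vec A n) → v ∈ allWords as n
allWords-complete as all-in []      = here refl
allWords-complete as all-in (a ∷ v) = ∈-cartesianProductWith⁺ _∷_ (all-in a) (allWords-complete as all-in v)

module NonPasswords (k L m : ℕ) (cat : Fin k → Fin L) (L≥3 : 3 ≤ L)
                    (surjective : ∀ c → ∃ λ a → cat a ≡ c) (a₀ : Fin k) where
  open Rotation {Fin k}

  Word : Set
  Word = Vec (Fin k) (suc m)

  NP : Word → Set
  NP = NonPassword cat

  Avoids : Fin L → ∀ {j} → Vec (Fin k) j → Set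
  Avoids c = All (λ a → cat a ≢ c)

  avoids-∷ʳ : ∀ {c j} {u : Vec (Fin k) j} {b} → Avoids c u → cat b ≢ c → Avoids c (u ∷ʳ b)
  avoids-∷ʳ []       b≁c = b≁c ∷ []
  avoids-∷ʳ (a≁c ∷ u) b≁c = a≁c ∷ avoids-∷ʳ u b≁c

  avoids-shift : ∀ {c} {w : Word} {b} → Avoids c w → cat b ≢ c → Avoids c (shift w b)
  avoids-shift (_ ∷ u) b≁c = avoids-∷ʳ u b≁c

  avoids-rot : ∀ {c} {w : Word} → Avoids c w → Avoids c (rot w)
  avoids-rot (a≁c ∷ u) = avoids-∷ʳ u a≁c

  avoids-replicate : ∀ {c b j} → cat b ≢ c → Avoids c (replicate j b)
  avoids-replicate {j = zero}  b≁c = []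
  avoids-replicate {j = suc j} b≁c = b≁c ∷ avoids-replicate b≁c

  avoids-lookup : ∀ {c j} (w : Vec (Fin k) j) → (∀ i → cat (lookup w i) ≢ c) → Avoids c w
  avoids-lookup []      avoid = []
  avoids-lookup (a ∷ w) avoid = avoid fzero ∷ avoids-lookup w (avoid ∘ fsuc)

  avoids⇒NP : ∀ {c} {w : Word} → Avoids c w → NP w
  avoids⇒NP {c} w-avoids = c , lookup⁺ w-avoids

  NP-rot : ∀ {w} → NP w → NP (rot w)
  NP-rot {w} (c , avoid) = avoids⇒NP (avoids-rot (avoids-lookup w avoid))

  NP? : ∀ w → Dec (NP w)
  NP? w = any? (λ c → all? (λ j → ¬? (cat (lookup w j) ≟ c)))

  open CycleJoining _≟_ NP (λ {w} → NP-rot {w}) hiding (Word)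

  feed : (s : Cycle) → ∀ {c j} {w : Word} → w ∈ words s → Avoids c w → (bs : Vec (Fin k) j) → Avoids c bs →
         Σ Cycle λ s′ → shiftIn w bs ∈ words s′ × s ⊑ s′
  feed s w∈ _ [] _ = s , w∈ , λ z∈ → z∈
  feed s {w = w} w∈ w-avoids (b ∷ bs) (b≁c ∷ bs-avoid)
    with extend s w∈ (avoids⇒NP (avoids-shift w-avoids b≁c)) (tail≡init-shift w b)
  ... | s₁ , w′∈ , s⊑s₁ with feed s₁ w′∈ (avoids-shift w-avoids b≁c) bs bs-avoid
  ...   | s₂ , z∈ , s₁⊑s₂ = s₂ , z∈ , s₁⊑s₂ ∘ s⊑s₁

  x₀ : Word
  x₀ = replicate (suc m) a₀

  -- From the constant word x₀ every non-password z is reached: first slide to bⁿ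
  -- for a letter b of a category e not missing from z (all windows avoid a category
  -- c″ ∉ {cat a₀, e}), then slide along z (all windows avoid the category c
  -- missing from z).
  reach : (s : Cycle) → x₀ ∈ words s → ∀ {z} → NP z → Σ Cycle λ s′ → z ∈ words s′ × s ⊑ s′
  reach s x₀∈ {z} (c , z-avoids) with third-category L≥3 c c
  ... | e , e≢c , _ with surjective e | third-category L≥3 (cat a₀) e
  ... | b , refl | c″ , c″≢a₀ , c″≢b
    with feed s x₀∈ (avoids-replicate (c″≢a₀ ∘ sym)) (replicate (suc m) b) (avoids-replicate (c″≢b ∘ sym))
  ... | s₁ , bⁿ∈ , s⊑s₁
    with feed s₁ (subst (_∈ words s₁) (shiftIn-full x₀ _) bⁿ∈) (avoids-replicate e≢c) z (avoids-lookup z z-avoids)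
  ... | s₂ , z∈ , s₁⊑s₂ = s₂ , subst (_∈ words s₂) (shiftIn-full _ z) z∈ , s₁⊑s₂ ∘ s⊑s₁

  add-all : (zs : List Word) (s : Cycle) → x₀ ∈ words s →
            Σ Cycle λ s′ → s ⊑ s′ × (∀ {z} → z ∈ zs → NP z → z ∈ words s′)
  add-all [] s _ = s , (λ z∈ → z∈) , λ ()
  add-all (z ∷ zs) s x₀∈ with NP? z
  ... | no ¬np with add-all zs s x₀∈
  ...   | s′ , s⊑s′ , covers = s′ , s⊑s′ , λ { (here refl) np → ⊥-elim (¬np np) ; (there z∈) → covers z∈ }
  add-all (z ∷ zs) s x₀∈ | yes np with reach s x₀∈ np
  ...   | s₁ , z∈s₁ , s⊑s₁ with add-all zs s₁ (s⊑s₁ x₀∈)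
  ...     | s′ , s₁⊑s′ , covers = s′ , s₁⊑s′ ∘ s⊑s₁ , λ { (here refl) _ → s₁⊑s′ z∈s₁ ; (there z∈) → covers z∈ }

  -- x₀ is a non-password: it misses any category other than cat a₀.
  x₀-NP : NP x₀
  x₀-NP = let c , c≢a₀ , _ = third-category L≥3 (cat a₀) (cat a₀) in avoids⇒NP (avoids-replicate (c≢a₀ ∘ sym))

  universal-cycle : UCycle (Fin k) (suc m) NP
  universal-cycle with necklace-cycle x₀-NP
  ... | s₀ , x₀∈s₀ with add-all (allWords (allFin k) (suc m)) s₀ x₀∈s₀
  ...   | s , s₀⊑s , covers = ReadOff.universal-cycle NP (words s) (closed s) (distinct s) (inC s)
                                (λ w np → covers (allWords-complete (allFin k) ∈-allFin w) np) (s₀⊑s x₀∈s₀)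

-- The theorem, for n = m + 1; as L ≥ 1, surjectivity provides a letter a₀ to start
-- from (the necklace of a₀ⁿ).
theorem8 : (n L k : ℕ) (cat : Fin k → Fin L) →
           1 ≤ n → 3 ≤ L →
           (∀ (c : Fin L) → ∃ λ (a : Fin k) → cat a ≡ c) →
           UCycle (Fin k) n (NonPassword cat)
theorem8 (suc m) L k cat _ L≥3@(s≤s _) surjective =
  NonPasswords.universal-cycle k L m cat L≥3 surjective (proj₁ (surjective fzero))
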